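{- Let $G$ be a cubic brick and let $e=uv$ be a forcing edge of $G$. Let $G^{\triangle}(u)$ be obtained from $G$ by a $Y\rightarrow\triangle$-operation on $u$. Then the edge $e'$ of $G^{\triangle}(u)$ corresponding to $e$ is not a forcing edge of $G^{\triangle}(u)$.
   Context: A $Y\rightarrow\triangle$-operation on a vertex $u$ with neighbours $y_1,y_2,y_3$ replaces $u$ by a triangle $u_1u_2u_3u_1$ and joins $u_i$ to $y_i$ ($i=1,2,3$); the edge corresponding to $uy_i$ is $u_iy_i$. An edge $e$ is forcing if it lies in exactly one perfect matching. A brick is a 3-connected bicritical graph. -}

module Defs where

open import Data.Nat using (ℕ; zero; suc; _+_; _≤_)
open import Data.Fin using (Fin; zero; suc; _≟_)
open import Data.Bool using (Bool; true; false; _∧_; _∨_; not; if_then_else_)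
open import Data.List using (List; map; allFin)
open import Data.Nat.ListAction using (sum)
open import Data.Product using (Σ; _×_; _,_)
open import Relation.Nullary using (¬_)
open import Relation.Nullary.Decidable using (⌊_⌋)
open import Relation.Binary.PropositionalEquality using (_≡_; _≢_)

Graph : ℕ → Set
Graph n = Fin n → Fin n → Bool

IsSimple : ∀ {n} → Graph n → Set
IsSimple {n} G = (∀ (x y : Fin n) → G x y ≡ G y x) × (∀ (x : Fin n) → G x x ≡ false)

VSet : ℕ → Set
VSet n = Fin n → Bool

full : ∀ {n} → VSet n
full _ = true

-- S minus the vertices x and y (x = y allowed: removes one vertex).
remove2 : ∀ {n} → VSet n → Fin n → Fin n → VSet n
remove2 S x y w = S w ∧ not ⌊ w ≟ x ⌋ ∧ not ⌊ w ≟ y ⌋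

degree : ∀ {n} → Graph n → Fin n → ℕ
degree {n} G v = sum (map (λ w → if G v w then 1 else 0) (allFin n))

IsCubic : ∀ {n} → Graph n → Set
IsCubic {n} G = ∀ (v : Fin n) → degree G v ≡ 3

data Walk {n} (G : Graph n) (S : VSet n) : Fin n → Fin n → Set where
  here : ∀ {a} → Walk G S a a
  step : ∀ {a c b} → G a c ≡ true → S c ≡ true → Walk G S c b → Walk G S a b

ConnectedOn : ∀ {n} → Graph n → VSet n → Set
ConnectedOn {n} G S = ∀ (a b : Fin n) → S a ≡ true → S b ≡ true → Walk G S a b

-- 3-connected: more than 3 vertices, and G - X connected for every |X| < 3.
ThreeConnected : ∀ {n} → Graph n → Set
ThreeConnected {n} G =
  4 ≤ n × ConnectedOn G full × (∀ (x y : Fin n) → ConnectedOn G (remove2 full x y))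

-- A perfect matching of the subgraph induced by S, encoded as the map
-- sending each vertex of S to its partner (a fixed-point-free involution on S
-- along edges of G).  Values outside S are irrelevant.
IsPMOn : ∀ {n} → Graph n → VSet n → (Fin n → Fin n) → Set
IsPMOn {n} G S m = ∀ (v : Fin n) → S v ≡ true →
  S (m v) ≡ true × m v ≢ v × m (m v) ≡ v × G v (m v) ≡ true

IsPM : ∀ {n} → Graph n → (Fin n → Fin n) → Set
IsPM G m = IsPMOn G full m

Bicritical : ∀ {n} → Graph n → Set
Bicritical {n} G = ∀ (x y : Fin n) → x ≢ y → Σ (Fin n → Fin n) (IsPMOn G (remove2 full x y))

IsBrick : ∀ {n} → Graph n → Set
IsBrick G = ThreeConnected G × Bicritical G

IsForcing : ∀ {n} → Graph n → Fin n → Fin n → Set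
IsForcing {n} G u v =
  G u v ≡ true ×
  Σ (Fin n → Fin n) (λ m → IsPM G m × m u ≡ v) ×
  (∀ (m m' : Fin n → Fin n) → IsPM G m → m u ≡ v → IsPM G m' → m' u ≡ v →
     ∀ (x : Fin n) → m x ≡ m' x)

-- Y→Δ on u, whose neighbours are v, y, z.  New vertex set Fin (2 + n):
-- old vertex w ↦ suc (suc w); u₁ = old u (keeps edge to v),
-- u₂ = zero (joined to y), u₃ = suc zero (joined to z); u₁u₂u₃ a triangle.
old : ∀ {n} → Fin n → Fin (suc (suc n))
old w = suc (suc w)

_==_ : ∀ {n} → Fin n → Fin n → Bool
a == b = ⌊ a ≟ b ⌋

YΔ : ∀ {n} → Graph n → (u y z : Fin n) → Graph (suc (suc n))
YΔ G u y z zero zero = false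
YΔ G u y z zero (suc zero) = true
YΔ G u y z (suc zero) zero = true
YΔ G u y z (suc zero) (suc zero) = false
YΔ G u y z zero (suc (suc w)) = (w == u) ∨ (w == y)
YΔ G u y z (suc (suc w)) zero = (w == u) ∨ (w == y)
YΔ G u y z (suc zero) (suc (suc w)) = (w == u) ∨ (w == z)
YΔ G u y z (suc (suc w)) (suc zero) = (w == u) ∨ (w == z)
YΔ G u y z (suc (suc w)) (suc (suc w')) =
  G w w' ∧ not (((w == u) ∧ ((w' == y) ∨ (w' == z))) ∨ ((w' == u) ∧ ((w == y) ∨ (w == z))))

{-# OPTIONS --safe #-}
module Submission where

open import Defs
open import Data.Nat using (ℕ; zero; suc; _+_; _≤_; s≤s; z≤n)
open import Data.Nat.Properties using (+-suc)
open import Data.Fin using (Fin; zero; suc; _≟_)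
open import Data.Bool using (Bool; true; false; _∧_; _∨_; if_then_else_)
open import Data.Bool.Properties using (∨-zeroʳ)
open import Data.List using (List; []; _∷_; length; map; allFin; tabulate)
open import Data.List.Properties using (map-tabulate)
open import Data.List.Relation.Unary.All as All using (All; []; _∷_)
open import Data.List.Relation.Unary.Unique.Propositional using (Unique; []; _∷_)
open import Data.Nat.ListAction using (sum)
open import Data.Product using (_×_; _,_; proj₁; proj₂)
open import Function using (_∘_)
open import Relation.Nullary using (¬_; yes; no; contradiction)
open import Relation.Nullary.Decidable using (isYes≗does; dec-true; dec-false)
open import Relation.Binary.PropositionalEquality
  using (_≡_; _≢_; refl; sym; trans; cong; subst; ≢-sym)

-- In G^Δ(u) the edge e' = u₁v lies both in M ∪ {u₂u₃}, for any perfect matching M of G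
-- through e, and in M' ∪ {u₂y, u₃z}, for a perfect matching M' of G - y - z, which exists
-- because G is bicritical.  As u has degree 3, the only neighbour of u left in G - y - z is v,
-- so M' also contains uv.  The two matchings differ at u₂, hence e' is not forcing.

count : ∀ {n} → (Fin n → Bool) → ℕ
count {zero}  f = 0
count {suc n} f = (if f zero then 1 else 0) + count (f ∘ suc)

remove : ∀ {n} → Fin n → (Fin n → Bool) → Fin n → Bool
remove zero    f zero    = false
remove zero    f (suc w) = f (suc w)
remove (suc a) f zero    = f zero
remove (suc a) f (suc w) = remove a (f ∘ suc) w

remove-true : ∀ {n} (f : Fin n → Bool) {a w : Fin n} → w ≢ a → f w ≡ true → remove a f w ≡ true
remove-true f {zero}  {zero}  w≢a fw = contradiction refl w≢a
remove-true f {zero}  {suc w} w≢a fw = fw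
remove-true f {suc a} {zero}  w≢a fw = fw
remove-true f {suc a} {suc w} w≢a fw = remove-true (f ∘ suc) (w≢a ∘ cong suc) fw

count-remove : ∀ {n} (f : Fin n → Bool) (a : Fin n) → f a ≡ true → count f ≡ suc (count (remove a f))
count-remove f zero    fa rewrite fa = refl
count-remove f (suc a) fa =
  trans (cong ((if f zero then 1 else 0) +_) (count-remove (f ∘ suc) a fa)) (+-suc _ _)

length≤count : ∀ {n} (f : Fin n → Bool) {xs : List (Fin n)} →
  Unique xs → All (λ x → f x ≡ true) xs → length xs ≤ count f
length≤count f []                []         = z≤n
length≤count f {x ∷ xs} (x∉xs ∷ uniq) (fx ∷ fxs) =
  subst (suc (length xs) ≤_) (sym (count-remove f x fx))
    (s≤s (length≤count (remove x f) uniq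
      (All.zipWith (λ (x≢w , fw) → remove-true f (≢-sym x≢w) fw) (x∉xs , fxs))))

sum-allFin≡count : ∀ {n} (f : Fin n → Bool) →
  sum (map (λ w → if f w then 1 else 0) (allFin n)) ≡ count f
sum-allFin≡count {zero}  f = refl
sum-allFin≡count {suc n} f = cong (ι zero +_) (trans (cong sum tail≡) (sum-allFin≡count (f ∘ suc)))
  where
  ι : Fin (suc n) → ℕ
  ι w = if f w then 1 else 0
  tail≡ : map ι (tabulate suc) ≡ map (ι ∘ suc) (allFin n)
  tail≡ = trans (map-tabulate suc ι) (sym (map-tabulate (λ w → w) (ι ∘ suc)))

degree≡count : ∀ {n} (G : Graph n) (v : Fin n) → degree G v ≡ count (G v)
degree≡count G v = sum-allFin≡count (G v)

degree3-fourth-neighbour : ∀ {n} (G : Graph n) {u a b c w : Fin n} → degree G u ≡ 3 →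
  G u a ≡ true → G u b ≡ true → G u c ≡ true → a ≢ b → a ≢ c → b ≢ c →
  G u w ≡ true → w ≢ b → w ≢ c → w ≡ a
degree3-fourth-neighbour G {u} {a} {b} {c} {w} deg ua ub uc a≢b a≢c b≢c uw w≢b w≢c with w ≟ a
... | yes w≡a = w≡a
... | no  w≢a = contradiction four≤three λ { (s≤s (s≤s (s≤s ()))) }
  where
  four≤three : 4 ≤ 3
  four≤three = subst (4 ≤_) (trans (sym (degree≡count G u)) deg)
    (length≤count (G u)
      ((a≢b ∷ a≢c ∷ ≢-sym w≢a ∷ []) ∷ (b≢c ∷ ≢-sym w≢b ∷ []) ∷ (≢-sym w≢c ∷ []) ∷ [] ∷ [])
      (ua ∷ ub ∷ uc ∷ uw ∷ []))

==-true : ∀ {n} {a b : Fin n} → a ≡ b → (a == b) ≡ true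
==-true {a = a} {b} a≡b = trans (isYes≗does (a ≟ b)) (dec-true (a ≟ b) a≡b)

==-false : ∀ {n} {a b : Fin n} → a ≢ b → (a == b) ≡ false
==-false {a = a} {b} a≢b = trans (isYes≗does (a ≟ b)) (dec-false (a ≟ b) a≢b)

old-injective : ∀ {n} {a b : Fin n} → old a ≡ old b → a ≡ b
old-injective refl = refl

remove2-true⇒≢ : ∀ {n} (S : VSet n) {x y w : Fin n} → remove2 S x y w ≡ true → w ≢ x × w ≢ y
remove2-true⇒≢ S {x} {y} {w} h with S w | w ≟ x | w ≟ y
remove2-true⇒≢ _ () | false | _       | _
remove2-true⇒≢ _ () | true  | yes _   | _
remove2-true⇒≢ _ () | true  | no _    | yes _
remove2-true⇒≢ _ _  | true  | no w≢x  | no w≢y = w≢x , w≢y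

remove2-intro : ∀ {n} (S : VSet n) {x y w : Fin n} → S w ≡ true → w ≢ x → w ≢ y → remove2 S x y w ≡ true
remove2-intro S Sw w≢x w≢y rewrite Sw | ==-false w≢x | ==-false w≢y = refl

module _ {n} (G : Graph n) (u y z : Fin n) where

  YΔ-spoke : ∀ (a : Fin n) {w} → w ≡ a → ((w == u) ∨ (w == a)) ≡ true
  YΔ-spoke a w≡a rewrite ==-true w≡a = ∨-zeroʳ _

  not-spoke : ∀ {a b : Fin n} → (a ≡ u → b ≢ y × b ≢ z) →
    ((a == u) ∧ ((b == y) ∨ (b == z))) ≡ false
  not-spoke {a} {b} h with a ≟ u
  ... | no  _   = refl
  ... | yes a≡u rewrite ==-false (proj₁ (h a≡u)) | ==-false (proj₂ (h a≡u)) = refl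

  YΔ-old : ∀ {a b : Fin n} → G a b ≡ true →
    (a ≡ u → b ≢ y × b ≢ z) → (b ≡ u → a ≢ y × a ≢ z) → YΔ G u y z (old a) (old b) ≡ true
  YΔ-old ab ha hb rewrite ab | not-spoke ha | not-spoke hb = refl

  extend-u₂u₃ : (Fin n → Fin n) → Fin (suc (suc n)) → Fin (suc (suc n))
  extend-u₂u₃ M zero          = suc zero
  extend-u₂u₃ M (suc zero)    = zero
  extend-u₂u₃ M (suc (suc w)) = old (M w)

  extend-u₂u₃-isPM : ∀ {M v} → IsPM G M → M u ≡ v → v ≢ y → v ≢ z →
    IsPM (YΔ G u y z) (extend-u₂u₃ M)
  extend-u₂u₃-isPM pm Mu≡v v≢y v≢z zero          _ = refl , (λ ()) , refl , refl
  extend-u₂u₃-isPM pm Mu≡v v≢y v≢z (suc zero)    _ = refl , (λ ()) , refl , refl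
  extend-u₂u₃-isPM {M} {v} pm Mu≡v v≢y v≢z (suc (suc w)) _ with pm w refl
  ... | _ , Mw≢w , MMw≡w , wMw = refl , Mw≢w ∘ old-injective , cong old MMw≡w , YΔ-old wMw at-u at-Mw
    where
    avoids : ∀ {x} → x ≡ v → x ≢ y × x ≢ z
    avoids refl = v≢y , v≢z
    at-u : w ≡ u → M w ≢ y × M w ≢ z
    at-u refl = avoids Mu≡v
    at-Mw : M w ≡ u → w ≢ y × w ≢ z
    at-Mw Mw≡u = avoids (trans (sym MMw≡w) (trans (cong M Mw≡u) Mu≡v))

  partner : (Fin n → Fin n) → Fin n → Fin (suc (suc n))
  partner M w with w ≟ y | w ≟ z
  ... | yes _ | _     = zero
  ... | no  _ | yes _ = suc zero
  ... | no  _ | no  _ = old (M w)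

  partner-y : ∀ M → partner M y ≡ zero
  partner-y M with y ≟ y
  ... | yes _   = refl
  ... | no  y≢y = contradiction refl y≢y

  partner-z : ∀ M → y ≢ z → partner M z ≡ suc zero
  partner-z M y≢z with z ≟ y | z ≟ z
  ... | yes z≡y | _       = contradiction (sym z≡y) y≢z
  ... | no  _   | yes _   = refl
  ... | no  _   | no  z≢z = contradiction refl z≢z

  partner-other : ∀ M {w} → w ≢ y → w ≢ z → partner M w ≡ old (M w)
  partner-other M {w} w≢y w≢z with w ≟ y | w ≟ z
  ... | yes w≡y | _       = contradiction w≡y w≢y
  ... | no  _   | yes w≡z = contradiction w≡z w≢z
  ... | no  _   | no  _   = refl

  extend-u₂y-u₃z : (Fin n → Fin n) → Fin (suc (suc n)) → Fin (suc (suc n))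
  extend-u₂y-u₃z M zero          = old y
  extend-u₂y-u₃z M (suc zero)    = old z
  extend-u₂y-u₃z M (suc (suc w)) = partner M w

  extend-u₂y-u₃z-isPM : ∀ {M} → y ≢ z → IsPMOn G (remove2 full y z) M →
    IsPM (YΔ G u y z) (extend-u₂y-u₃z M)
  extend-u₂y-u₃z-isPM {M} y≢z pm zero       _ = refl , (λ ()) , partner-y M , YΔ-spoke y refl
  extend-u₂y-u₃z-isPM {M} y≢z pm (suc zero) _ = refl , (λ ()) , partner-z M y≢z , YΔ-spoke z refl
  extend-u₂y-u₃z-isPM {M} y≢z pm (suc (suc w)) _ with w ≟ y | w ≟ z
  ... | yes w≡y | _       = refl , (λ ()) , cong old (sym w≡y) , YΔ-spoke y w≡y
  ... | no  _   | yes w≡z = refl , (λ ()) , cong old (sym w≡z) , YΔ-spoke z w≡z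
  ... | no  w≢y | no  w≢z with pm w (remove2-intro full refl w≢y w≢z)
  ...   | Mw∈ , Mw≢w , MMw≡w , wMw =
    refl , Mw≢w ∘ old-injective , trans (partner-other M Mw≢y Mw≢z) (cong old MMw≡w) ,
    YΔ-old wMw (λ _ → Mw≢y , Mw≢z) (λ _ → w≢y , w≢z)
    where
    Mw≢y : M w ≢ y
    Mw≢y = proj₁ (remove2-true⇒≢ full Mw∈)
    Mw≢z : M w ≢ z
    Mw≢z = proj₂ (remove2-true⇒≢ full Mw∈)

distinct-matchings⇒¬forcing : ∀ {n} (G : Graph n) {a b x : Fin n} {m m' : Fin n → Fin n} →
  IsPM G m → IsPM G m' → m a ≡ b → m' a ≡ b → m x ≢ m' x → ¬ IsForcing G a b
distinct-matchings⇒¬forcing G pm pm' ma≡b m'a≡b mx≢m'x (_ , _ , unique) =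
  mx≢m'x (unique _ _ pm ma≡b pm' m'a≡b _)

loopless-adjacent⇒≢ : ∀ {n} (G : Graph n) {a b : Fin n} → (∀ x → G x x ≡ false) → G a b ≡ true → a ≢ b
loopless-adjacent⇒≢ G loopless ab refl with trans (sym (loopless _)) ab
... | ()

lemma2 : ∀ {n : ℕ} (G : Graph n) (u v y z : Fin n) →
    IsSimple G → IsCubic G → IsBrick G → IsForcing G u v →
    G u y ≡ true → G u z ≡ true → v ≢ y → v ≢ z → y ≢ z →
    ¬ IsForcing (YΔ G u y z) (old u) (old v)
lemma2 G u v y z (_ , loopless) cubic (_ , bicritical) (uv , (M , M-pm , Mu≡v) , _) uy uz v≢y v≢z y≢z
  with bicritical y z y≢z
... | M' , M'-pm =
  distinct-matchings⇒¬forcing (YΔ G u y z) {x = zero}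
    (extend-u₂u₃-isPM G u y z M-pm Mu≡v v≢y v≢z)
    (extend-u₂y-u₃z-isPM G u y z y≢z M'-pm)
    (cong old Mu≡v)
    (trans (partner-other G u y z M' u≢y u≢z) (cong old M'u≡v))
    λ ()
  where
  u≢y : u ≢ y
  u≢y = loopless-adjacent⇒≢ G loopless uy
  u≢z : u ≢ z
  u≢z = loopless-adjacent⇒≢ G loopless uz
  M'u≡v : M' u ≡ v
  M'u≡v with M'-pm u (remove2-intro full refl u≢y u≢z)
  ... | M'u∈ , _ , _ , uM'u =
    degree3-fourth-neighbour G (cubic u) uv uy uz v≢y v≢z y≢z uM'u
      (proj₁ (remove2-true⇒≢ full M'u∈)) (proj₂ (remove2-true⇒≢ full M'u∈))
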